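{- Let $G$ be a finite graph on $n$ vertices, let $\lambda,\beta,\gamma>0$, and suppose that $G$ satisfies local $(\beta,\gamma)$-occupancy at fugacity $\lambda$. Let $I$ be a random independent set drawn from the hard-core model $\mu_{G,\lambda}$ and let $d_u$ be the degree of $u$ in $G$. Then \[ \frac{1}{n}\sum_{u\in V(G)} \Pr(u\in I)\cdot(\beta+d_u\gamma)\ge 1. \]
   Context: For a graph $H$, $Z_H(\lambda)=\sum_{I}\lambda^{|I|}$ where the sum is over all independent sets of $H$ (including the empty set); the hard-core model on $G$ at fugacity $\lambda>0$ is the measure $\mu_{G,\lambda}(I)=\lambda^{|I|}/Z_G(\lambda)$ on independent sets of $G$. $N(u)$ is the neighborhood of $u$ and $G[N(u)]$ the induced subgraph on it. $G$ satisfies local $(\beta,\gamma)$-occupancy at fugacity $\lambda$ if for every vertex $u\in V(G)$ and every induced subgraph $F$ of $G[N(u)]$ (including the empty graph), \[ \beta\frac{\lambda}{1+\lambda}\frac{1}{Z_F(\lambda)}+\gamma\frac{\lambda Z_F'(\lambda)}{Z_F(\lambda)}\ge 1. \] -}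

module Defs where

open import Level using (Level; suc; _⊔_)
open import Data.Bool using (Bool; true; false; _∧_; not; if_then_else_)
open import Data.Nat as ℕ using (ℕ)
open import Data.Fin using (Fin)
open import Data.Vec using (Vec; []; _∷_; lookup)
open import Data.List using (List; []; _∷_; map; _++_; foldr; filterᵇ; length)
open import Data.Bool.ListAction using (all)
open import Data.List using () renaming (allFin to allFinL)
open import Data.Product using (_×_)
open import Relation.Binary.PropositionalEquality using (_≡_; _≢_)
open import Relation.Binary.Structures using (IsTotalOrder)
open import Algebra.Structures using (IsCommutativeRing)
open import Relation.Nullary using (¬_)

-- Ordered fields (the reals ℝ are the intended instance).  Standard
-- axioms: commutative ring, total order compatible with + and *,
-- 0 ≠ 1, every nonzero element has a multiplicative inverse.
-- (x ⁻¹ is a total function; its value at 0 is unconstrained.)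

record OrderedField (c ℓ : Level) : Set (suc (c ⊔ ℓ)) where
  infixl 7 _*_
  infixl 6 _+_
  infix 4 _≤_
  field
    Carrier : Set c
    _+_ _*_ : Carrier → Carrier → Carrier
    -_ : Carrier → Carrier
    0# 1# : Carrier
    _⁻¹ : Carrier → Carrier
    _≤_ : Carrier → Carrier → Set ℓ
    isCommutativeRing : IsCommutativeRing _≡_ _+_ _*_ -_ 0# 1#
    isTotalOrder : IsTotalOrder _≡_ _≤_
    0≢1 : 0# ≢ 1#
    ⁻¹-inverse : ∀ x → x ≢ 0# → x * (x ⁻¹) ≡ 1#
    +-mono-≤ : ∀ x y z → x ≤ y → x + z ≤ y + z
    *-nonneg : ∀ x y → 0# ≤ x → 0# ≤ y → 0# ≤ x * y

  infix 4 _<_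
  _<_ : Carrier → Carrier → Set (c ⊔ ℓ)
  x < y = (x ≤ y) × (x ≢ y)

  infixl 7 _÷_
  _÷_ : Carrier → Carrier → Carrier
  x ÷ y = x * (y ⁻¹)

  ι : ℕ → Carrier
  ι ℕ.zero = 0#
  ι (ℕ.suc k) = 1# + ι k

  infixr 8 _^_
  _^_ : Carrier → ℕ → Carrier
  x ^ ℕ.zero = 1#
  x ^ ℕ.suc k = x * (x ^ k)

  Σ[_] : {A : Set} → List A → (A → Carrier) → Carrier
  Σ[ xs ] f = foldr (λ a acc → f a + acc) 0# xs

record Graph (n : ℕ) : Set where
  field
    adj : Fin n → Fin n → Bool
    sym : ∀ i j → adj i j ≡ adj j i
    irrefl : ∀ i → adj i i ≡ false
open Graph public

VSet : ℕ → Set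
VSet n = Vec Bool n

_∈ᵇ_ : ∀ {n} → Fin n → VSet n → Bool
i ∈ᵇ S = lookup S i

allSubsets : ∀ n → List (VSet n)
allSubsets ℕ.zero = [] ∷ []
allSubsets (ℕ.suc n) = map (true ∷_) (allSubsets n) ++ map (false ∷_) (allSubsets n)

card : ∀ {n} → VSet n → ℕ
card [] = 0
card (true ∷ S) = ℕ.suc (card S)
card (false ∷ S) = card S

_⊆ᵇ_ : ∀ {n} → VSet n → VSet n → Bool
T ⊆ᵇ S = all (λ i → not (i ∈ᵇ T) Data.Bool.∨ (i ∈ᵇ S)) (allFinL _)
  where import Data.Bool

isIndep : ∀ {n} → Graph n → VSet n → Bool
isIndep {n} G T =
  all (λ i → all (λ j → not ((i ∈ᵇ T) ∧ (j ∈ᵇ T) ∧ adj G i j)) (allFinL n)) (allFinL n)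

-- independent sets of the induced subgraph G[S]  (= independent sets of G contained in S)
indepSetsIn : ∀ {n} → Graph n → VSet n → List (VSet n)
indepSetsIn {n} G S = filterᵇ (λ T → isIndep G T ∧ (T ⊆ᵇ S)) (allSubsets n)

fullSet : ∀ n → VSet n
fullSet ℕ.zero = []
fullSet (ℕ.suc n) = true ∷ fullSet n

nbhd : ∀ {n} → Graph n → Fin n → VSet n
nbhd {n} G u = Data.Vec.tabulate (λ v → adj G u v)
  where import Data.Vec

degree : ∀ {n} → Graph n → Fin n → ℕ
degree G u = card (nbhd G u)

module _ {c ℓ} (K : OrderedField c ℓ) where
  open OrderedField K

  Z : ∀ {n} → Graph n → VSet n → Carrier → Carrier
  Z G S fug = Σ[ indepSetsIn G S ] (λ T → fug ^ card T)

  -- fug Z'_{G[S]}(fug) = Σ_{I indep in G[S]} |I| fug^|I|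
  fugZ' : ∀ {n} → Graph n → VSet n → Carrier → Carrier
  fugZ' G S fug = Σ[ indepSetsIn G S ] (λ T → ι (card T) * fug ^ card T)

  ZG : ∀ {n} → Graph n → Carrier → Carrier
  ZG {n} G fug = Z G (fullSet n) fug

  occProb : ∀ {n} → Graph n → Carrier → Fin n → Carrier
  occProb {n} G fug u =
    Σ[ indepSetsIn G (fullSet n) ] (λ T → if u ∈ᵇ T then fug ^ card T else 0#) ÷ ZG G fug

  -- local (β,γ)-occupancy at fugacity fug: for every vertex u and every
  -- induced subgraph F = G[S] of G[N(u)] (i.e. every S ⊆ N(u), including ∅)
  LocalOccupancy : ∀ {n} → Graph n → (β γ fug : Carrier) → Set ℓ
  LocalOccupancy {n} G β γ fug =
    ∀ (u : Fin n) (S : VSet n) → (S ⊆ᵇ nbhd G u) ≡ true →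
      1# ≤ β * (fug ÷ (1# + fug)) * (1# ÷ Z G S fug) + γ * (fugZ' G S fug ÷ Z G S fug)

-- Fix a vertex u and write an independent set I as J ∪ K with J = I ∖ N(u) and
-- K = I ∩ N(u). Given J, the admissible K are exactly the independent sets of
-- F_J = G[uncovered G J (N(u))], the neighbours of u with no neighbour in J. Hence,
-- writing λ for fug,
--   Z_G = Σ_J λ^|J| Z_{F_J}   and   Σ_I λ^|I| |I ∩ N(u)| = Σ_J λ^|J| λZ'_{F_J},
-- with J ranging over the independent sets disjoint from N(u), while toggling u
-- shows Σ_{I ∋ u} λ^|I| = λ/(1+λ) Σ_J λ^|J|. Multiplying the local occupancy
-- inequality for F_J by λ^|J| and summing over J gives
--   Z_G ≤ β Σ_{I ∋ u} λ^|I| + γ Σ_I λ^|I| |I ∩ N(u)|,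
-- and summing over u, with Σ_u |I ∩ N(u)| = Σ_{v ∈ I} d_v, yields
--   n Z_G ≤ Z_G Σ_u Pr(u ∈ I) (β + d_u γ).

{-# OPTIONS --safe #-}
module Submission where

open import Defs hiding (sym)
open import Algebra.Bundles using (CommutativeRing)
open import Algebra.Structures using (IsCommutativeRing)
open import Data.Bool using (Bool; true; false; not; _∧_; _∨_; if_then_else_)
open import Data.Bool.Properties using (⇔→≡; T-≡; ∧-identityʳ; ∧-comm)
open import Data.Bool.ListAction using (all; and)
open import Data.Fin using (Fin; zero; suc; _≟_)
open import Data.Fin.Subset using (_∪_; _∩_; ∁) renaming (⊥ to ∅)
open import Data.List using (List; []; _∷_; _++_; map; filterᵇ; allFin)
open import Data.List.Properties using (map-tabulate)
open import Data.List.Relation.Unary.All.Properties using (all⁺; all⁻; tabulate⁺; tabulate⁻)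
open import Data.Maybe using (nothing)
open import Data.Nat using (ℕ)
import Data.Nat as ℕ
open import Data.Nat.Properties using (+-suc)
open import Data.Product using (_×_; _,_; proj₁; proj₂)
open import Data.Product.Function.NonDependent.Propositional using (_×-⇔_)
open import Data.Sum using (_⊎_; inj₁; inj₂)
open import Data.Vec using ([]; _∷_; updateAt) renaming (tabulate to tabulateᵥ)
open import Data.Vec.Properties
  using (lookup-replicate; lookup∘tabulate; lookup-zipWith; lookup-map; lookup∘updateAt; lookup∘updateAt′)
open import Function using (_∘_; id; _⇔_; mk⇔; Equivalence)
import Function.Properties.Equivalence as ⇔
open import Relation.Binary.PropositionalEquality
open import Relation.Binary.Structures using (IsTotalOrder)
open import Relation.Nullary using (¬_; yes; no; contradiction)
open import Tactic.RingSolver.Core.AlmostCommutativeRing using (fromCommutativeRing)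

open Equivalence using (to; from)

private
  variable
    n : ℕ
    a b : Bool

∧≡true⇔ : a ∧ b ≡ true ⇔ (a ≡ true × b ≡ true)
∧≡true⇔ {true}  = mk⇔ (refl ,_) proj₂
∧≡true⇔ {false} = mk⇔ (λ ()) λ { (() , _) }

∨≡true⇔ : a ∨ b ≡ true ⇔ (a ≡ true ⊎ b ≡ true)
∨≡true⇔ {true}  = mk⇔ inj₁ (λ _ → refl)
∨≡true⇔ {false} = mk⇔ inj₂ λ { (inj₁ ()) ; (inj₂ b) → b }

not≡true⇔ : not a ≡ true ⇔ a ≡ false
not≡true⇔ {true}  = mk⇔ (λ ()) (λ ())
not≡true⇔ {false} = mk⇔ (λ _ → refl) (λ _ → refl)

∧≡false⇔ : a ∧ b ≡ false ⇔ (a ≡ true → b ≡ false)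
∧≡false⇔ {true}  = mk⇔ (λ b≡false _ → b≡false) (λ f → f refl)
∧≡false⇔ {false} = mk⇔ (λ _ ()) (λ _ → refl)

implication≡true⇔ : not a ∨ b ≡ true ⇔ (a ≡ true → b ≡ true)
implication≡true⇔ {true}  = mk⇔ (λ b≡true _ → b≡true) (λ f → f refl)
implication≡true⇔ {false} = mk⇔ (λ _ ()) (λ _ → refl)

all-allFin⇔ : (p : Fin n → Bool) → all p (allFin n) ≡ true ⇔ (∀ i → p i ≡ true)
all-allFin⇔ p = mk⇔
  (λ h i → to T-≡ (tabulate⁻ (all⁺ p (allFin _) (from T-≡ h)) i))
  (λ h → to T-≡ (all⁻ p (tabulate⁺ (λ i → from T-≡ (h i)))))

all-allFin-suc : (p : Fin (ℕ.suc n) → Bool) →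
                 all p (allFin (ℕ.suc n)) ≡ p zero ∧ all (p ∘ suc) (allFin n)
all-allFin-suc p =
  cong (λ bs → p zero ∧ and bs) (trans (map-tabulate suc p) (sym (map-tabulate id (p ∘ suc))))

infix 4 _∈_ _⊆_

_∈_ : Fin n → VSet n → Set
i ∈ S = i ∈ᵇ S ≡ true

_⊆_ : VSet n → VSet n → Set
S ⊆ S′ = ∀ {i} → i ∈ S → i ∈ S′

Independent : Graph n → VSet n → Set
Independent G S = ∀ {i j} → i ∈ S → j ∈ S → adj G i j ≡ false

⊆ᵇ⇔⊆ : (S S′ : VSet n) → (S ⊆ᵇ S′) ≡ true ⇔ S ⊆ S′
⊆ᵇ⇔⊆ S S′ = mk⇔
  (λ h {i} → to implication≡true⇔ (to (all-allFin⇔ _) h i))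
  (λ h → from (all-allFin⇔ _) (λ i → from implication≡true⇔ (h {i})))

isIndep⇔Independent : (G : Graph n) (S : VSet n) → isIndep G S ≡ true ⇔ Independent G S
isIndep⇔Independent {n} G S = ⇔.trans (all-allFin⇔ _) (mk⇔
  (λ h {i} {j} i∈S j∈S →
     to ∧≡false⇔ (to ∧≡false⇔ (to not≡true⇔ (to (all-allFin⇔ (noEdge i)) (h i) j)) i∈S) j∈S)
  (λ I i → from (all-allFin⇔ (noEdge i)) λ j →
     from not≡true⇔ (from ∧≡false⇔ λ i∈S → from ∧≡false⇔ λ j∈S → I i∈S j∈S)))
  where
  noEdge : Fin n → Fin n → Bool
  noEdge i j = not (i ∈ᵇ S ∧ j ∈ᵇ S ∧ adj G i j)

⊆ᵇ-∷ : ∀ a b (S S′ : VSet n) → ((a ∷ S) ⊆ᵇ (b ∷ S′)) ≡ (not a ∨ b) ∧ (S ⊆ᵇ S′)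
⊆ᵇ-∷ a b S S′ = all-allFin-suc (λ i → not (i ∈ᵇ (a ∷ S)) ∨ (i ∈ᵇ (b ∷ S′)))

⊆ᵇ-∷⁻ : ∀ a b (S S′ : VSet n) → ((a ∷ S) ⊆ᵇ (b ∷ S′)) ≡ true →
        (not a ∨ b ≡ true) × (S ⊆ᵇ S′) ≡ true
⊆ᵇ-∷⁻ a b S S′ h = to ∧≡true⇔ (trans (sym (⊆ᵇ-∷ a b S S′)) h)

∈ᵇ-nbhd : ∀ (G : Graph n) u v → v ∈ᵇ nbhd G u ≡ adj G u v
∈ᵇ-nbhd G u v = lookup∘tabulate (adj G u) v

∈ᵇ-∩ : ∀ i (S S′ : VSet n) → i ∈ᵇ (S ∩ S′) ≡ i ∈ᵇ S ∧ i ∈ᵇ S′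
∈ᵇ-∩ i S S′ = lookup-zipWith _∧_ i S S′

∈-∪⇔ : ∀ {i} (S S′ : VSet n) → i ∈ S ∪ S′ ⇔ (i ∈ S ⊎ i ∈ S′)
∈-∪⇔ {i = i} S S′ rewrite lookup-zipWith _∨_ i S S′ = ∨≡true⇔

∈-∁nbhd⇔ : ∀ (G : Graph n) {u v} → v ∈ ∁ (nbhd G u) ⇔ adj G u v ≡ false
∈-∁nbhd⇔ G {u} {v} rewrite lookup-map v not (nbhd G u) | ∈ᵇ-nbhd G u v = not≡true⇔

uncovered : Graph n → VSet n → VSet n → VSet n
uncovered {n} G J M = tabulateᵥ (λ v → v ∈ᵇ M ∧ all (λ j → not (j ∈ᵇ J ∧ adj G j v)) (allFin n))

∈-uncovered⇔ : ∀ (G : Graph n) J M {v} →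
  v ∈ uncovered G J M ⇔ (v ∈ M × (∀ {j} → j ∈ J → adj G j v ≡ false))
∈-uncovered⇔ {n} G J M {v}
  rewrite lookup∘tabulate (λ v → v ∈ᵇ M ∧ all (λ j → not (j ∈ᵇ J ∧ adj G j v)) (allFin n)) v =
  ⇔.trans ∧≡true⇔ (⇔.refl ×-⇔ ⇔.trans (all-allFin⇔ _)
    (mk⇔ (λ h {j} → to ∧≡false⇔ (to not≡true⇔ (h j)))
         (λ h j → from not≡true⇔ (from ∧≡false⇔ (h {j})))))

module _ (G : Graph n) where

  uncovered-⊆ : ∀ J M → uncovered G J M ⊆ M
  uncovered-⊆ J M = proj₁ ∘ to (∈-uncovered⇔ G J M)

  ⊆ᵇ-uncovered⇒⊆ᵇ : ∀ J K M → (K ⊆ᵇ uncovered G J M) ≡ true → (K ⊆ᵇ M) ≡ true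
  ⊆ᵇ-uncovered⇒⊆ᵇ J K M K⊆U =
    from (⊆ᵇ⇔⊆ K M) (uncovered-⊆ J M ∘ to (⊆ᵇ⇔⊆ K (uncovered G J M)) K⊆U)

  Independent-∪⇔ : ∀ J K M →
    (K ⊆ M × Independent G (J ∪ K)) ⇔ (Independent G J × Independent G K × K ⊆ uncovered G J M)
  Independent-∪⇔ J K M = mk⇔ restrict combine
    where
    J⊆J∪K : J ⊆ J ∪ K
    J⊆J∪K = from (∈-∪⇔ J K) ∘ inj₁
    K⊆J∪K : K ⊆ J ∪ K
    K⊆J∪K = from (∈-∪⇔ J K) ∘ inj₂

    restrict : K ⊆ M × Independent G (J ∪ K) →
               Independent G J × Independent G K × K ⊆ uncovered G J M
    restrict (K⊆M , I) =
        (λ i∈J j∈J → I (J⊆J∪K i∈J) (J⊆J∪K j∈J))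
      , (λ i∈K j∈K → I (K⊆J∪K i∈K) (K⊆J∪K j∈K))
      , (λ k∈K → from (∈-uncovered⇔ G J M) (K⊆M k∈K , λ j∈J → I (J⊆J∪K j∈J) (K⊆J∪K k∈K)))

    combine : Independent G J × Independent G K × K ⊆ uncovered G J M →
              K ⊆ M × Independent G (J ∪ K)
    combine (IJ , IK , K⊆U) = uncovered-⊆ J M ∘ K⊆U , independent
      where
      no-edge-to : ∀ {k} → k ∈ uncovered G J M → ∀ {j} → j ∈ J → adj G j k ≡ false
      no-edge-to = proj₂ ∘ to (∈-uncovered⇔ G J M)
      independent : Independent G (J ∪ K)
      independent {i} {j} i∈ j∈ with to (∈-∪⇔ J K) i∈ | to (∈-∪⇔ J K) j∈
      ... | inj₁ i∈J | inj₁ j∈J = IJ i∈J j∈J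
      ... | inj₂ i∈K | inj₂ j∈K = IK i∈K j∈K
      ... | inj₁ i∈J | inj₂ j∈K = no-edge-to (K⊆U j∈K) i∈J
      ... | inj₂ i∈K | inj₁ j∈J = trans (Graph.sym G i j) (no-edge-to (K⊆U i∈K) j∈J)

  isIndep-∪ : ∀ J K M →
    (K ⊆ᵇ M) ∧ isIndep G (J ∪ K) ≡ isIndep G J ∧ (isIndep G K ∧ (K ⊆ᵇ uncovered G J M))
  isIndep-∪ J K M = ⇔→≡ (⇔.trans ∧≡true⇔
    (⇔.trans (⊆ᵇ⇔⊆ K M ×-⇔ isIndep⇔Independent G (J ∪ K))
    (⇔.trans (Independent-∪⇔ J K M)
    (⇔.sym (⇔.trans ∧≡true⇔ (isIndep⇔Independent G J ×-⇔
            ⇔.trans ∧≡true⇔ (isIndep⇔Independent G K ×-⇔ ⊆ᵇ⇔⊆ K (uncovered G J M))))))))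

toggle : Fin n → VSet n → VSet n
toggle u S = updateAt S u not

∈ᵇ-toggle : ∀ (u : Fin n) S → u ∈ᵇ toggle u S ≡ not (u ∈ᵇ S)
∈ᵇ-toggle u S = lookup∘updateAt u S

card-toggle : ∀ (u : Fin n) S → u ∈ᵇ S ≡ false → card (toggle u S) ≡ ℕ.suc (card S)
card-toggle zero    (false ∷ S) _   = refl
card-toggle (suc u) (true ∷ S)  u∉S = cong ℕ.suc (card-toggle u S u∉S)
card-toggle (suc u) (false ∷ S) u∉S = card-toggle u S u∉S

∈-toggle⇔ : ∀ (u v : Fin n) S → u ∈ᵇ S ≡ false → v ∈ toggle u S ⇔ (v ≡ u ⊎ v ∈ S)
∈-toggle⇔ u v S u∉S = mk⇔ split join
  where
  split : v ∈ toggle u S → v ≡ u ⊎ v ∈ S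
  split v∈ with v ≟ u
  ... | yes v≡u = inj₁ v≡u
  ... | no v≢u  = inj₂ (trans (sym (lookup∘updateAt′ v u v≢u S)) v∈)
  join : v ≡ u ⊎ v ∈ S → v ∈ toggle u S
  join (inj₁ refl) = trans (∈ᵇ-toggle u S) (cong not u∉S)
  join (inj₂ v∈S)  = trans (lookup∘updateAt′ v u v≢u S) v∈S
    where
    v≢u : v ≢ u
    v≢u refl = contradiction (trans (sym v∈S) u∉S) λ ()

module _ (G : Graph n) where

  Independent-toggle⇔ : ∀ u S → u ∈ᵇ S ≡ false →
    Independent G (toggle u S) ⇔ (S ⊆ ∁ (nbhd G u) × Independent G S)
  Independent-toggle⇔ u S u∉S = mk⇔ restrict combine
    where
    u∈ : u ∈ toggle u S
    u∈ = from (∈-toggle⇔ u u S u∉S) (inj₁ refl)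
    S⊆ : S ⊆ toggle u S
    S⊆ {v} = from (∈-toggle⇔ u v S u∉S) ∘ inj₂

    restrict : Independent G (toggle u S) → S ⊆ ∁ (nbhd G u) × Independent G S
    restrict I = (λ v∈S → from (∈-∁nbhd⇔ G) (I u∈ (S⊆ v∈S)))
               , (λ i∈S j∈S → I (S⊆ i∈S) (S⊆ j∈S))

    combine : S ⊆ ∁ (nbhd G u) × Independent G S → Independent G (toggle u S)
    combine (S⊆∁N , IS) {i} {j} i∈ j∈
      with to (∈-toggle⇔ u i S u∉S) i∈ | to (∈-toggle⇔ u j S u∉S) j∈
    ... | inj₁ refl | inj₁ refl = irrefl G u
    ... | inj₁ refl | inj₂ j∈S  = to (∈-∁nbhd⇔ G) (S⊆∁N j∈S)
    ... | inj₂ i∈S  | inj₁ refl = trans (Graph.sym G i u) (to (∈-∁nbhd⇔ G) (S⊆∁N i∈S))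
    ... | inj₂ i∈S  | inj₂ j∈S  = IS i∈S j∈S

  isIndep-toggle : ∀ u S → u ∈ᵇ S ≡ false →
    isIndep G (toggle u S) ≡ (S ⊆ᵇ ∁ (nbhd G u)) ∧ isIndep G S
  isIndep-toggle u S u∉S = ⇔→≡ (⇔.trans (isIndep⇔Independent G (toggle u S))
    (⇔.trans (Independent-toggle⇔ u S u∉S)
      (⇔.sym (⇔.trans ∧≡true⇔ (⊆ᵇ⇔⊆ S (∁ (nbhd G u)) ×-⇔ isIndep⇔Independent G S)))))

  isIndep-∋ : ∀ u S → u ∈ S → (S ⊆ᵇ ∁ (nbhd G u)) ∧ isIndep G S ≡ isIndep G S
  isIndep-∋ u S u∈S = ⇔→≡ (mk⇔ (proj₂ ∘ to ∧≡true⇔) λ I →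
    from ∧≡true⇔ (from (⊆ᵇ⇔⊆ S (∁ (nbhd G u))) (λ v∈S →
      from (∈-∁nbhd⇔ G) (to (isIndep⇔Independent G S) I u∈S v∈S)) , I))

card-∪ : ∀ (M J K : VSet n) → (J ⊆ᵇ ∁ M) ≡ true → (K ⊆ᵇ M) ≡ true →
         card (J ∪ K) ≡ card J ℕ.+ card K
card-∪ [] [] [] _ _ = refl
card-∪ (m ∷ M) (j ∷ J) (k ∷ K) J⊆∁M K⊆M
  with ⊆ᵇ-∷⁻ j (not m) J (∁ M) J⊆∁M | ⊆ᵇ-∷⁻ k m K M K⊆M
... | j⇒¬m , J⊆∁M′ | k⇒m , K⊆M′ = step m j k j⇒¬m k⇒m (card-∪ M J K J⊆∁M′ K⊆M′)
  where
  step : ∀ m j k → not j ∨ not m ≡ true → not k ∨ m ≡ true → card (J ∪ K) ≡ card J ℕ.+ card K →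
         card ((j ∨ k) ∷ (J ∪ K)) ≡ card (j ∷ J) ℕ.+ card (k ∷ K)
  step true  false true  _ _ eq = trans (cong ℕ.suc eq) (sym (+-suc (card J) (card K)))
  step true  false false _ _ eq = eq
  step false true  false _ _ eq = cong ℕ.suc eq
  step false false false _ _ eq = eq

∩-∪-cancel : ∀ (M J K : VSet n) → (J ⊆ᵇ ∁ M) ≡ true → (K ⊆ᵇ M) ≡ true → M ∩ (J ∪ K) ≡ K
∩-∪-cancel [] [] [] _ _ = refl
∩-∪-cancel (m ∷ M) (j ∷ J) (k ∷ K) J⊆∁M K⊆M
  with ⊆ᵇ-∷⁻ j (not m) J (∁ M) J⊆∁M | ⊆ᵇ-∷⁻ k m K M K⊆M
... | j⇒¬m , J⊆∁M′ | k⇒m , K⊆M′ =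
  cong₂ _∷_ (head m j k j⇒¬m k⇒m) (∩-∪-cancel M J K J⊆∁M′ K⊆M′)
  where
  head : ∀ m j k → not j ∨ not m ≡ true → not k ∨ m ≡ true → m ∧ (j ∨ k) ≡ k
  head true  false k     _ _ = refl
  head false j     false _ _ = refl

∉∅ : ∀ (i : Fin n) → ¬ i ∈ ∅
∉∅ i i∈∅ = contradiction (trans (sym i∈∅) (lookup-replicate i false)) λ ()

∅-⊆ᵇ : (S : VSet n) → (∅ ⊆ᵇ S) ≡ true
∅-⊆ᵇ S = from (⊆ᵇ⇔⊆ ∅ S) λ {i} i∈∅ → contradiction i∈∅ (∉∅ i)

isIndep-∅ : (G : Graph n) → isIndep G ∅ ≡ true
isIndep-∅ G = from (isIndep⇔Independent G ∅) λ {i} i∈∅ → contradiction i∈∅ (∉∅ i)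

card-∅ : ∀ n → card (∅ {n}) ≡ 0
card-∅ ℕ.zero    = refl
card-∅ (ℕ.suc n) = card-∅ n

⊆ᵇ-fullSet : (S : VSet n) → (S ⊆ᵇ fullSet n) ≡ true
⊆ᵇ-fullSet {n} S = from (⊆ᵇ⇔⊆ S (fullSet n)) λ {i} _ → ∈-fullSet i
  where
  ∈-fullSet : ∀ {n} (i : Fin n) → i ∈ fullSet n
  ∈-fullSet zero    = refl
  ∈-fullSet (suc i) = ∈-fullSet i

subsetsOf : VSet n → List (VSet n)
subsetsOf []          = [] ∷ []
subsetsOf (true ∷ M)  = map (true ∷_) (subsetsOf M) ++ map (false ∷_) (subsetsOf M)
subsetsOf (false ∷ M) = map (false ∷_) (subsetsOf M)

module OrderedFieldProperties {c ℓ} (K : OrderedField c ℓ) where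
  open OrderedField K
  open IsCommutativeRing isCommutativeRing
    using (+-assoc; +-comm; +-identityˡ; +-identityʳ; *-assoc; *-comm; *-identityˡ; *-identityʳ;
           zeroˡ; zeroʳ; distribˡ; distribʳ; -‿inverseʳ)
  open IsTotalOrder isTotalOrder using (total; antisym) renaming (refl to ≤-refl; trans to ≤-trans)

  commutativeRing : CommutativeRing c c
  commutativeRing = record { isCommutativeRing = isCommutativeRing }

  open import Tactic.RingSolver.NonReflective (fromCommutativeRing commutativeRing (λ _ → nothing))
    public using (solve; _⊕_; _⊗_; _⊜_)
  open import Algebra.Properties.Ring (CommutativeRing.ring commutativeRing)
    using (-1*x≈-x; -‿involutive; -‿distribʳ-*; x[y-z]≈xy-xz; //-rightDividesˡ)
  open import Algebra.Properties.CommutativeSemigroup (CommutativeRing.*-commutativeSemigroup commutativeRing)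
    public using () renaming (x∙yz≈y∙xz to x*[y*z]≡y*[x*z]; xy∙z≈y∙xz to x*y*z≡y*[x*z])

  x≤y⇒0≤y-x : ∀ {x y} → x ≤ y → 0# ≤ y + - x
  x≤y⇒0≤y-x {x} {y} x≤y = subst (_≤ y + - x) (-‿inverseʳ x) (+-mono-≤ x y (- x) x≤y)

  0≤y-x⇒x≤y : ∀ {x y} → 0# ≤ y + - x → x ≤ y
  0≤y-x⇒x≤y {x} {y} 0≤y-x =
    subst₂ _≤_ (+-identityˡ x) (//-rightDividesˡ x y) (+-mono-≤ 0# (y + - x) x 0≤y-x)

  0≤1 : 0# ≤ 1#
  0≤1 with total 0# 1#
  ... | inj₁ 0≤1 = 0≤1
  ... | inj₂ 1≤0 = contradiction (antisym 0≤1′ 1≤0) 0≢1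
    where
    0≤-1 : 0# ≤ - 1#
    0≤-1 = subst (0# ≤_) (+-identityˡ (- 1#)) (x≤y⇒0≤y-x 1≤0)
    0≤1′ : 0# ≤ 1#
    0≤1′ = subst (0# ≤_) (trans (-1*x≈-x (- 1#)) (-‿involutive 1#)) (*-nonneg _ _ 0≤-1 0≤-1)

  +-mono₂-≤ : ∀ {a b x y} → a ≤ b → x ≤ y → a + x ≤ b + y
  +-mono₂-≤ {a} {b} {x} {y} a≤b x≤y =
    ≤-trans (+-mono-≤ a b x a≤b) (subst₂ _≤_ (+-comm x b) (+-comm y b) (+-mono-≤ x y b x≤y))

  *-monoˡ-≤-nonneg : ∀ {a x y} → 0# ≤ a → x ≤ y → a * x ≤ a * y
  *-monoˡ-≤-nonneg {a} {x} {y} 0≤a x≤y =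
    0≤y-x⇒x≤y (subst (0# ≤_) (x[y-z]≈xy-xz a y x) (*-nonneg _ _ 0≤a (x≤y⇒0≤y-x x≤y)))

  1≤⇒0≤ : ∀ {x} → 1# ≤ x → 0# ≤ x
  1≤⇒0≤ = ≤-trans 0≤1

  1≤⇒≢0 : ∀ {x} → 1# ≤ x → x ≢ 0#
  1≤⇒≢0 1≤x refl = 0≢1 (antisym 0≤1 1≤x)

  ⁻¹-nonneg : ∀ {x} → 0# ≤ x → x ≢ 0# → 0# ≤ x ⁻¹
  ⁻¹-nonneg {x} 0≤x x≢0 with total 0# (x ⁻¹)
  ... | inj₁ 0≤x⁻¹ = 0≤x⁻¹
  ... | inj₂ x⁻¹≤0 = contradiction (antisym 0≤1 1≤0) 0≢1
    where
    0≤-x⁻¹ : 0# ≤ - (x ⁻¹)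
    0≤-x⁻¹ = subst (0# ≤_) (+-identityˡ _) (x≤y⇒0≤y-x x⁻¹≤0)
    1≤0 : 1# ≤ 0#
    1≤0 = 0≤y-x⇒x≤y (subst (0# ≤_) (trans (sym (-‿distribʳ-* x (x ⁻¹)))
                                            (trans (cong -_ (⁻¹-inverse x x≢0)) (sym (+-identityˡ (- 1#)))))
                       (*-nonneg _ _ 0≤x 0≤-x⁻¹))

  ι-nonneg : ∀ k → 0# ≤ ι k
  ι-nonneg ℕ.zero    = ≤-refl
  ι-nonneg (ℕ.suc k) = subst (_≤ 1# + ι k) (+-identityˡ 0#) (+-mono₂-≤ 0≤1 (ι-nonneg k))

  1≤1+x : ∀ {x} → 0# ≤ x → 1# ≤ 1# + x
  1≤1+x {x} 0≤x = subst (_≤ 1# + x) (+-identityʳ 1#) (+-mono₂-≤ ≤-refl 0≤x)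

  ^-nonneg : ∀ {x} k → 0# ≤ x → 0# ≤ x ^ k
  ^-nonneg ℕ.zero    _   = 0≤1
  ^-nonneg (ℕ.suc k) 0≤x = *-nonneg _ _ 0≤x (^-nonneg k 0≤x)

  ^-distribˡ-+-* : ∀ x i j → x ^ (i ℕ.+ j) ≡ x ^ i * x ^ j
  ^-distribˡ-+-* x ℕ.zero    j = sym (*-identityˡ _)
  ^-distribˡ-+-* x (ℕ.suc i) j = trans (cong (x *_) (^-distribˡ-+-* x i j)) (sym (*-assoc x _ _))

  *-÷-cancel : ∀ {y z} → z ≢ 0# → z * (y ÷ z) ≡ y
  *-÷-cancel {y} {z} z≢0 =
    trans (x*[y*z]≡y*[x*z] z y (z ⁻¹)) (trans (cong (y *_) (⁻¹-inverse z z≢0)) (*-identityʳ y))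

  ≤⇒1≤* : ∀ {a x z} → 0# ≤ a → a * z ≡ 1# → z ≤ x → 1# ≤ a * x
  ≤⇒1≤* {a} {x} 0≤a a*z≡1 z≤x = subst (_≤ a * x) a*z≡1 (*-monoˡ-≤-nonneg 0≤a z≤x)

  [1÷x]*y⁻¹*[x*y]≡1 : ∀ {x y} → x ≢ 0# → y ≢ 0# → (1# ÷ x) * y ⁻¹ * (x * y) ≡ 1#
  [1÷x]*y⁻¹*[x*y]≡1 {x} {y} x≢0 y≢0 = begin
    (1# ÷ x) * y ⁻¹ * (x * y)     ≡⟨ cong (λ t → t * y ⁻¹ * (x * y)) (*-identityˡ (x ⁻¹)) ⟩
    x ⁻¹ * y ⁻¹ * (x * y)         ≡⟨ regroup (x ⁻¹) (y ⁻¹) x y ⟩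
    (x * x ⁻¹) * (y * y ⁻¹)       ≡⟨ cong₂ _*_ (⁻¹-inverse x x≢0) (⁻¹-inverse y y≢0) ⟩
    1# * 1#                       ≡⟨ *-identityˡ 1# ⟩
    1#                            ∎
    where
    open ≡-Reasoning
    regroup : ∀ a b x y → a * b * (x * y) ≡ (x * a) * (y * b)
    regroup = solve 4 (λ a b x y → (a ⊗ b ⊗ (x ⊗ y)) ⊜ ((x ⊗ a) ⊗ (y ⊗ b))) refl

  1≤÷⇒≤ : ∀ {y z} → 1# ≤ z → 1# ≤ y ÷ z → z ≤ y
  1≤÷⇒≤ {y} {z} 1≤z 1≤y÷z =
    subst₂ _≤_ (*-identityʳ z) (*-÷-cancel (1≤⇒≢0 1≤z)) (*-monoˡ-≤-nonneg (1≤⇒0≤ 1≤z) 1≤y÷z)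

  ⟦_⟧_ : Bool → Carrier → Carrier
  ⟦ b ⟧ x = if b then x else 0#

  ⟦⟧-cong : ∀ b {x y} → (b ≡ true → x ≡ y) → ⟦ b ⟧ x ≡ ⟦ b ⟧ y
  ⟦⟧-cong true  x≡y = x≡y refl
  ⟦⟧-cong false _   = refl

  ⟦⟧-∧ : ∀ a b {x} → ⟦ a ⟧ ⟦ b ⟧ x ≡ ⟦ a ∧ b ⟧ x
  ⟦⟧-∧ true  _ = refl
  ⟦⟧-∧ false _ = refl

  ⟦⟧-0 : ∀ b → ⟦ b ⟧ 0# ≡ 0#
  ⟦⟧-0 true  = refl
  ⟦⟧-0 false = refl

  ⟦⟧-*ˡ : ∀ b x y → ⟦ b ⟧ (x * y) ≡ x * ⟦ b ⟧ y
  ⟦⟧-*ˡ true  x y = refl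
  ⟦⟧-*ˡ false x y = sym (zeroʳ x)

  ⟦⟧-*ʳ : ∀ b x y → ⟦ b ⟧ x * y ≡ ⟦ b ⟧ (x * y)
  ⟦⟧-*ʳ true  x y = refl
  ⟦⟧-*ʳ false x y = zeroˡ y

  ⟦⟧-mono : ∀ b {x y} → x ≤ y → ⟦ b ⟧ x ≤ ⟦ b ⟧ y
  ⟦⟧-mono true  x≤y = x≤y
  ⟦⟧-mono false _   = ≤-refl

  ⟦⟧-nonneg : ∀ b {x} → 0# ≤ x → 0# ≤ ⟦ b ⟧ x
  ⟦⟧-nonneg true  0≤x = 0≤x
  ⟦⟧-nonneg false _   = ≤-refl

  module _ {A : Set} where

    Σ-cong : ∀ (xs : List A) {f g : A → Carrier} → (∀ x → f x ≡ g x) → Σ[ xs ] f ≡ Σ[ xs ] g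
    Σ-cong []       f≗g = refl
    Σ-cong (x ∷ xs) f≗g = cong₂ _+_ (f≗g x) (Σ-cong xs f≗g)

    Σ-0 : ∀ (xs : List A) → Σ[ xs ] (λ _ → 0#) ≡ 0#
    Σ-0 []       = refl
    Σ-0 (x ∷ xs) = trans (cong (0# +_) (Σ-0 xs)) (+-identityˡ 0#)

    Σ-+ : ∀ (xs : List A) (f g : A → Carrier) → Σ[ xs ] (λ x → f x + g x) ≡ Σ[ xs ] f + Σ[ xs ] g
    Σ-+ []       f g = sym (+-identityˡ 0#)
    Σ-+ (x ∷ xs) f g = trans (cong (f x + g x +_) (Σ-+ xs f g)) (interchange (f x) (g x) _ _)
      where
      interchange : ∀ a b c d → a + b + (c + d) ≡ a + c + (b + d)
      interchange = solve 4 (λ a b c d → (a ⊕ b ⊕ (c ⊕ d)) ⊜ (a ⊕ c ⊕ (b ⊕ d))) refl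

    Σ-*ˡ : ∀ (xs : List A) k (f : A → Carrier) → Σ[ xs ] (λ x → k * f x) ≡ k * Σ[ xs ] f
    Σ-*ˡ []       k f = sym (zeroʳ k)
    Σ-*ˡ (x ∷ xs) k f = trans (cong (k * f x +_) (Σ-*ˡ xs k f)) (sym (distribˡ k _ _))

    Σ-*ʳ : ∀ (xs : List A) k (f : A → Carrier) → Σ[ xs ] (λ x → f x * k) ≡ Σ[ xs ] f * k
    Σ-*ʳ xs k f = trans (Σ-cong xs (λ x → *-comm (f x) k)) (trans (Σ-*ˡ xs k f) (*-comm k _))

    Σ-⟦⟧ : ∀ (xs : List A) b (f : A → Carrier) → Σ[ xs ] (λ x → ⟦ b ⟧ f x) ≡ ⟦ b ⟧ Σ[ xs ] f
    Σ-⟦⟧ xs true  f = refl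
    Σ-⟦⟧ xs false f = Σ-0 xs

    Σ-mono : ∀ (xs : List A) {f g : A → Carrier} → (∀ x → f x ≤ g x) → Σ[ xs ] f ≤ Σ[ xs ] g
    Σ-mono []       f≤g = ≤-refl
    Σ-mono (x ∷ xs) f≤g = +-mono₂-≤ (f≤g x) (Σ-mono xs f≤g)

    Σ-nonneg : ∀ (xs : List A) {f : A → Carrier} → (∀ x → 0# ≤ f x) → 0# ≤ Σ[ xs ] f
    Σ-nonneg xs 0≤f = subst (_≤ Σ[ xs ] _) (Σ-0 xs) (Σ-mono xs 0≤f)

    Σ-++ : ∀ (xs ys : List A) (f : A → Carrier) → Σ[ xs ++ ys ] f ≡ Σ[ xs ] f + Σ[ ys ] f
    Σ-++ []       ys f = sym (+-identityˡ _)
    Σ-++ (x ∷ xs) ys f = trans (cong (f x +_) (Σ-++ xs ys f)) (sym (+-assoc _ _ _))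

    Σ-filter : ∀ (xs : List A) (p : A → Bool) (f : A → Carrier) →
               Σ[ filterᵇ p xs ] f ≡ Σ[ xs ] (λ x → ⟦ p x ⟧ f x)
    Σ-filter []       p f = refl
    Σ-filter (x ∷ xs) p f with p x
    ... | true  = cong (f x +_) (Σ-filter xs p f)
    ... | false = trans (Σ-filter xs p f) (sym (+-identityˡ _))

  Σ-map : ∀ {A B : Set} (xs : List A) (g : A → B) (f : B → Carrier) → Σ[ map g xs ] f ≡ Σ[ xs ] (f ∘ g)
  Σ-map []       g f = refl
  Σ-map (x ∷ xs) g f = cong (f (g x) +_) (Σ-map xs g f)

  Σ-swap : ∀ {A B : Set} (xs : List A) (ys : List B) (f : A → B → Carrier) →
           Σ[ xs ] (λ x → Σ[ ys ] (f x)) ≡ Σ[ ys ] (λ y → Σ[ xs ] (λ x → f x y))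
  Σ-swap []       ys f = sym (Σ-0 ys)
  Σ-swap (x ∷ xs) ys f = trans (cong (Σ[ ys ] (f x) +_) (Σ-swap xs ys f)) (sym (Σ-+ ys (f x) _))

  Σ-allFin-suc : ∀ n (f : Fin (ℕ.suc n) → Carrier) →
                 Σ[ allFin (ℕ.suc n) ] f ≡ f zero + Σ[ allFin n ] (f ∘ suc)
  Σ-allFin-suc n f =
    cong (f zero +_) (trans (cong (λ xs → Σ[ xs ] f) (sym (map-tabulate id suc))) (Σ-map (allFin n) suc f))

  Σ-allFin-const : ∀ n k → Σ[ allFin n ] (λ _ → k) ≡ ι n * k
  Σ-allFin-const ℕ.zero    k = sym (zeroˡ k)
  Σ-allFin-const (ℕ.suc n) k = begin
    Σ[ allFin (ℕ.suc n) ] (λ _ → k) ≡⟨ Σ-allFin-suc n _ ⟩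
    k + Σ[ allFin n ] (λ _ → k)     ≡⟨ cong (k +_) (Σ-allFin-const n k) ⟩
    k + ι n * k                     ≡⟨ cong (_+ ι n * k) (sym (*-identityˡ k)) ⟩
    1# * k + ι n * k                ≡⟨ sym (distribʳ k 1# (ι n)) ⟩
    (1# + ι n) * k                  ∎
    where open ≡-Reasoning

  ι-card : ∀ {n} (S : VSet n) → ι (card S) ≡ Σ[ allFin n ] (λ v → ⟦ v ∈ᵇ S ⟧ 1#)
  ι-card []                  = refl
  ι-card {ℕ.suc n} (true ∷ S)  = trans (cong (1# +_) (ι-card S)) (sym (Σ-allFin-suc n _))
  ι-card {ℕ.suc n} (false ∷ S) = trans (ι-card S) (trans (sym (+-identityˡ _)) (sym (Σ-allFin-suc n _)))

  Σ-∷-split : ∀ (Ss : List (VSet n)) (f : VSet (ℕ.suc n) → Carrier) →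
    Σ[ map (true ∷_) Ss ++ map (false ∷_) Ss ] f ≡ Σ[ Ss ] (f ∘ (true ∷_)) + Σ[ Ss ] (f ∘ (false ∷_))
  Σ-∷-split Ss f = trans (Σ-++ (map (true ∷_) Ss) _ f) (cong₂ _+_ (Σ-map Ss _ f) (Σ-map Ss _ f))

  Σ-subsetsOf : ∀ (M : VSet n) (f : VSet n → Carrier) →
    Σ[ subsetsOf M ] f ≡ Σ[ allSubsets n ] (λ K → ⟦ K ⊆ᵇ M ⟧ f K)
  Σ-subsetsOf []          f = refl
  Σ-subsetsOf {ℕ.suc n} (m ∷ M) f = begin
    Σ[ subsetsOf (m ∷ M) ] f                                       ≡⟨ split m ⟩
    Σ[ subsets ] (λ K → ⟦ (true ∷ K) ⊆ᵇ (m ∷ M) ⟧ f (true ∷ K))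
      + Σ[ subsets ] (λ K → ⟦ (false ∷ K) ⊆ᵇ (m ∷ M) ⟧ f (false ∷ K)) ≡⟨ Σ-∷-split subsets _ ⟨
    Σ[ allSubsets (ℕ.suc n) ] (λ K → ⟦ K ⊆ᵇ (m ∷ M) ⟧ f K)       ∎
    where
    open ≡-Reasoning
    subsets : List (VSet n)
    subsets = allSubsets n
    head : ∀ a b → Σ[ subsets ] (λ K → ⟦ (not a ∨ b) ∧ (K ⊆ᵇ M) ⟧ f (a ∷ K))
                 ≡ Σ[ subsets ] (λ K → ⟦ (a ∷ K) ⊆ᵇ (b ∷ M) ⟧ f (a ∷ K))
    head a b = Σ-cong subsets λ K → cong (λ c → ⟦ c ⟧ f (a ∷ K)) (sym (⊆ᵇ-∷ a b K M))
    split : ∀ m → Σ[ subsetsOf (m ∷ M) ] f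
                ≡ Σ[ subsets ] (λ K → ⟦ (true ∷ K) ⊆ᵇ (m ∷ M) ⟧ f (true ∷ K))
                  + Σ[ subsets ] (λ K → ⟦ (false ∷ K) ⊆ᵇ (m ∷ M) ⟧ f (false ∷ K))
    split true  = trans (Σ-∷-split (subsetsOf M) f)
                        (cong₂ _+_ (trans (Σ-subsetsOf M _) (head true true))
                                   (trans (Σ-subsetsOf M _) (head false true)))
    split false = trans (Σ-map (subsetsOf M) _ f)
                        (trans (sym (+-identityˡ _))
                               (cong₂ _+_ (trans (sym (Σ-0 subsets)) (head true false))
                                          (trans (Σ-subsetsOf M _) (head false false))))

  Σ-allSubsets-∪ : ∀ (M : VSet n) (f : VSet n → Carrier) →
    Σ[ allSubsets n ] f ≡ Σ[ subsetsOf (∁ M) ] (λ J → Σ[ subsetsOf M ] (λ K → f (J ∪ K)))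
  Σ-allSubsets-∪ []          f = sym (+-identityʳ _)
  Σ-allSubsets-∪ {ℕ.suc n} (true ∷ M)  f = begin
    Σ[ allSubsets (ℕ.suc n) ] f
      ≡⟨ Σ-∷-split (allSubsets n) f ⟩
    Σ[ allSubsets n ] (f ∘ (true ∷_)) + Σ[ allSubsets n ] (f ∘ (false ∷_))
      ≡⟨ cong₂ _+_ (Σ-allSubsets-∪ M _) (Σ-allSubsets-∪ M _) ⟩
    Σ[ S∁ ] (λ J → Σ[ S ] (λ K → f (true ∷ (J ∪ K))))
      + Σ[ S∁ ] (λ J → Σ[ S ] (λ K → f (false ∷ (J ∪ K))))
      ≡⟨ Σ-+ S∁ _ _ ⟨
    Σ[ S∁ ] (λ J → Σ[ S ] (λ K → f (true ∷ (J ∪ K))) + Σ[ S ] (λ K → f (false ∷ (J ∪ K))))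
      ≡⟨ Σ-cong S∁ (λ J → Σ-∷-split S (λ K → f ((false ∷ J) ∪ K))) ⟨
    Σ[ S∁ ] (λ J → Σ[ subsetsOf (true ∷ M) ] (λ K → f ((false ∷ J) ∪ K)))
      ≡⟨ Σ-map S∁ _ _ ⟨
    Σ[ subsetsOf (∁ (true ∷ M)) ] (λ J → Σ[ subsetsOf (true ∷ M) ] (λ K → f (J ∪ K)))
      ∎
    where
    open ≡-Reasoning
    S : List (VSet n)
    S = subsetsOf M
    S∁ : List (VSet n)
    S∁ = subsetsOf (∁ M)
  Σ-allSubsets-∪ {ℕ.suc n} (false ∷ M) f = begin
    Σ[ allSubsets (ℕ.suc n) ] f
      ≡⟨ Σ-∷-split (allSubsets n) f ⟩
    Σ[ allSubsets n ] (f ∘ (true ∷_)) + Σ[ allSubsets n ] (f ∘ (false ∷_))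
      ≡⟨ cong₂ _+_ (Σ-allSubsets-∪ M _) (Σ-allSubsets-∪ M _) ⟩
    Σ[ S∁ ] (λ J → Σ[ S ] (λ K → f (true ∷ (J ∪ K))))
      + Σ[ S∁ ] (λ J → Σ[ S ] (λ K → f (false ∷ (J ∪ K))))
      ≡⟨ cong₂ _+_ (Σ-cong S∁ λ J → Σ-map S _ _) (Σ-cong S∁ λ J → Σ-map S _ _) ⟨
    Σ[ S∁ ] (λ J → Σ[ subsetsOf (false ∷ M) ] (λ K → f ((true ∷ J) ∪ K)))
      + Σ[ S∁ ] (λ J → Σ[ subsetsOf (false ∷ M) ] (λ K → f ((false ∷ J) ∪ K)))
      ≡⟨ Σ-∷-split S∁ _ ⟨
    Σ[ subsetsOf (∁ (false ∷ M)) ] (λ J → Σ[ subsetsOf (false ∷ M) ] (λ K → f (J ∪ K)))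
      ∎
    where
    open ≡-Reasoning
    S : List (VSet n)
    S = subsetsOf M
    S∁ : List (VSet n)
    S∁ = subsetsOf (∁ M)

  Σ-allSubsets-toggle : ∀ (u : Fin n) (f : VSet n → Carrier) →
    Σ[ allSubsets n ] f ≡ Σ[ allSubsets n ] (f ∘ toggle u)
  Σ-allSubsets-toggle {ℕ.suc n} zero    f =
    trans (Σ-∷-split (allSubsets n) f) (trans (+-comm _ _) (sym (Σ-∷-split (allSubsets n) _)))
  Σ-allSubsets-toggle {ℕ.suc n} (suc u) f =
    trans (Σ-∷-split (allSubsets n) f)
      (trans (cong₂ _+_ (Σ-allSubsets-toggle u _) (Σ-allSubsets-toggle u _)) (sym (Σ-∷-split (allSubsets n) _)))

  ∅≤Σ-allSubsets : ∀ n (f : VSet n → Carrier) → (∀ S → 0# ≤ f S) → f ∅ ≤ Σ[ allSubsets n ] f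
  ∅≤Σ-allSubsets ℕ.zero    f 0≤f = subst (f [] ≤_) (sym (+-identityʳ _)) ≤-refl
  ∅≤Σ-allSubsets (ℕ.suc n) f 0≤f =
    subst₂ _≤_ (+-identityˡ _) (sym (Σ-∷-split (allSubsets n) f))
      (+-mono₂-≤ (Σ-nonneg (allSubsets n) (0≤f ∘ (true ∷_)))
                 (∅≤Σ-allSubsets n (f ∘ (false ∷_)) (0≤f ∘ (false ∷_))))

module HardCoreModel {c ℓ} (K : OrderedField c ℓ) {n : ℕ} (G : Graph n) (fug : OrderedField.Carrier K) where
  open OrderedField K
  open OrderedFieldProperties K
  open IsCommutativeRing isCommutativeRing
    using (+-identityˡ; +-identityʳ; +-comm; *-identityˡ; *-identityʳ; *-assoc; *-comm; zeroʳ; distribˡ; distribʳ)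

  weight : VSet n → Carrier
  weight S = fug ^ card S

  θ : Carrier
  θ = fug ÷ (1# + fug)

  occupancyWeight : Fin n → Carrier
  occupancyWeight u = Σ[ indepSetsIn G (fullSet n) ] (λ T → if u ∈ᵇ T then weight T else 0#)

  neighbourWeight : Fin n → Carrier
  neighbourWeight u = Σ[ indepSetsIn G (fullSet n) ] (λ T → ι (card (nbhd G u ∩ T)) * weight T)

  Σ-indepSetsIn : ∀ S (f : VSet n → Carrier) →
    Σ[ indepSetsIn G S ] f ≡ Σ[ allSubsets n ] (λ T → ⟦ isIndep G T ∧ (T ⊆ᵇ S) ⟧ f T)
  Σ-indepSetsIn S = Σ-filter (allSubsets n) _

  Σ-indepSets : ∀ (f : VSet n → Carrier) →
    Σ[ indepSetsIn G (fullSet n) ] f ≡ Σ[ allSubsets n ] (λ T → ⟦ isIndep G T ⟧ f T)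
  Σ-indepSets f = trans (Σ-indepSetsIn (fullSet n) f) (Σ-cong (allSubsets n) λ T →
    cong (λ b → ⟦ b ⟧ f T) (trans (cong (isIndep G T ∧_) (⊆ᵇ-fullSet T)) (∧-identityʳ _)))

  1≤Z : 0# ≤ fug → ∀ S → 1# ≤ Z K G S fug
  1≤Z 0≤fug S = subst₂ _≤_ weight-∅ (sym (Σ-indepSetsIn S weight))
    (∅≤Σ-allSubsets n _ λ T → ⟦⟧-nonneg (isIndep G T ∧ (T ⊆ᵇ S)) (^-nonneg (card T) 0≤fug))
    where
    weight-∅ : ⟦ isIndep G ∅ ∧ (∅ ⊆ᵇ S) ⟧ weight ∅ ≡ 1#
    weight-∅ rewrite isIndep-∅ G | ∅-⊆ᵇ S | card-∅ n = refl

  Σ-degree≡Σ-card-nbhd-∩ : ∀ T → Σ[ allFin n ] (λ u → ⟦ u ∈ᵇ T ⟧ ι (degree G u))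
                 ≡ Σ[ allFin n ] (λ v → ι (card (nbhd G v ∩ T)))
  Σ-degree≡Σ-card-nbhd-∩ T = begin
    Σ[ Vs ] (λ u → ⟦ u ∈ᵇ T ⟧ ι (degree G u))
      ≡⟨ Σ-cong Vs (λ u → trans (cong (⟦ u ∈ᵇ T ⟧_) (ι-card (nbhd G u))) (sym (Σ-⟦⟧ Vs _ _))) ⟩
    Σ[ Vs ] (λ u → Σ[ Vs ] (λ v → ⟦ u ∈ᵇ T ⟧ ⟦ v ∈ᵇ nbhd G u ⟧ 1#))
      ≡⟨ Σ-swap Vs Vs _ ⟩
    Σ[ Vs ] (λ v → Σ[ Vs ] (λ u → ⟦ u ∈ᵇ T ⟧ ⟦ v ∈ᵇ nbhd G u ⟧ 1#))
      ≡⟨ Σ-cong Vs (λ v → Σ-cong Vs λ u → trans (⟦⟧-∧ (u ∈ᵇ T) _) (cong (λ b → ⟦ b ⟧ 1#) (edge v u))) ⟩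
    Σ[ Vs ] (λ v → Σ[ Vs ] (λ u → ⟦ u ∈ᵇ (nbhd G v ∩ T) ⟧ 1#))
      ≡⟨ Σ-cong Vs (λ v → ι-card (nbhd G v ∩ T)) ⟨
    Σ[ Vs ] (λ v → ι (card (nbhd G v ∩ T)))
      ∎
    where
    open ≡-Reasoning
    Vs : List (Fin n)
    Vs = allFin n
    edge : ∀ v u → u ∈ᵇ T ∧ v ∈ᵇ nbhd G u ≡ u ∈ᵇ (nbhd G v ∩ T)
    edge v u = begin
      u ∈ᵇ T ∧ v ∈ᵇ nbhd G u    ≡⟨ cong (u ∈ᵇ T ∧_) (trans (∈ᵇ-nbhd G u v) (Graph.sym G u v)) ⟩
      u ∈ᵇ T ∧ adj G v u        ≡⟨ ∧-comm (u ∈ᵇ T) _ ⟩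
      adj G v u ∧ u ∈ᵇ T        ≡⟨ cong (_∧ u ∈ᵇ T) (∈ᵇ-nbhd G v u) ⟨
      u ∈ᵇ nbhd G v ∧ u ∈ᵇ T    ≡⟨ ∈ᵇ-∩ u (nbhd G v) T ⟨
      u ∈ᵇ (nbhd G v ∩ T)       ∎

  Σ-occupancyWeight*degree : Σ[ allFin n ] (λ u → occupancyWeight u * ι (degree G u))
                     ≡ Σ[ allFin n ] neighbourWeight
  Σ-occupancyWeight*degree = begin
    Σ[ Vs ] (λ u → occupancyWeight u * d u)
      ≡⟨ Σ-cong Vs (λ u → Σ-*ʳ Is (d u) _) ⟨
    Σ[ Vs ] (λ u → Σ[ Is ] (λ T → ⟦ u ∈ᵇ T ⟧ weight T * d u))
      ≡⟨ Σ-swap Vs Is _ ⟩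
    Σ[ Is ] (λ T → Σ[ Vs ] (λ u → ⟦ u ∈ᵇ T ⟧ weight T * d u))
      ≡⟨ Σ-cong Is (λ T → Σ-cong Vs (commute T)) ⟨
    Σ[ Is ] (λ T → Σ[ Vs ] (λ u → ⟦ u ∈ᵇ T ⟧ d u * weight T))
      ≡⟨ Σ-cong Is (λ T → trans (Σ-*ʳ Vs _ _) (cong (_* weight T) (Σ-degree≡Σ-card-nbhd-∩ T))) ⟩
    Σ[ Is ] (λ T → Σ[ Vs ] (λ u → ι (card (nbhd G u ∩ T))) * weight T)
      ≡⟨ Σ-cong Is (λ T → Σ-*ʳ Vs _ _) ⟨
    Σ[ Is ] (λ T → Σ[ Vs ] (λ u → ι (card (nbhd G u ∩ T)) * weight T))
      ≡⟨ Σ-swap Is Vs _ ⟩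
    Σ[ Vs ] neighbourWeight
      ∎
    where
    open ≡-Reasoning
    Vs : List (Fin n)
    Vs = allFin n
    Is : List (VSet n)
    Is = indepSetsIn G (fullSet n)
    d : Fin n → Carrier
    d u = ι (degree G u)
    commute : ∀ T u → ⟦ u ∈ᵇ T ⟧ d u * weight T ≡ ⟦ u ∈ᵇ T ⟧ weight T * d u
    commute T u = trans (⟦⟧-*ʳ (u ∈ᵇ T) _ _)
                        (trans (cong (⟦ u ∈ᵇ T ⟧_) (*-comm _ _)) (sym (⟦⟧-*ʳ (u ∈ᵇ T) _ _)))

  Σ-indep-∪ : ∀ (M : VSet n) (g : VSet n → Carrier) →
    Σ[ allSubsets n ] (λ T → ⟦ isIndep G T ⟧ g T)
    ≡ Σ[ allSubsets n ] (λ J → ⟦ (J ⊆ᵇ ∁ M) ∧ isIndep G J ⟧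
        Σ[ allSubsets n ] (λ K → ⟦ isIndep G K ∧ (K ⊆ᵇ uncovered G J M) ⟧ g (J ∪ K)))
  Σ-indep-∪ M g = begin
    Σ[ Ss ] (λ T → ⟦ isIndep G T ⟧ g T)
      ≡⟨ Σ-allSubsets-∪ M _ ⟩
    Σ[ subsetsOf (∁ M) ] (λ J → Σ[ subsetsOf M ] (λ K → ⟦ isIndep G (J ∪ K) ⟧ g (J ∪ K)))
      ≡⟨ Σ-subsetsOf (∁ M) _ ⟩
    Σ[ Ss ] (λ J → ⟦ J ⊆ᵇ ∁ M ⟧ Σ[ subsetsOf M ] (λ K → ⟦ isIndep G (J ∪ K) ⟧ g (J ∪ K)))
      ≡⟨ Σ-cong Ss (λ J → cong (⟦ J ⊆ᵇ ∁ M ⟧_) (trans (Σ-subsetsOf M _) (inner J))) ⟩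
    Σ[ Ss ] (λ J → ⟦ J ⊆ᵇ ∁ M ⟧ ⟦ isIndep G J ⟧ Σ[ Ss ] (λ K → ⟦ free J K ⟧ g (J ∪ K)))
      ≡⟨ Σ-cong Ss (λ J → ⟦⟧-∧ (J ⊆ᵇ ∁ M) (isIndep G J)) ⟩
    Σ[ Ss ] (λ J → ⟦ (J ⊆ᵇ ∁ M) ∧ isIndep G J ⟧ Σ[ Ss ] (λ K → ⟦ free J K ⟧ g (J ∪ K)))
      ∎
    where
    open ≡-Reasoning
    Ss : List (VSet n)
    Ss = allSubsets n
    free : VSet n → VSet n → Bool
    free J K = isIndep G K ∧ (K ⊆ᵇ uncovered G J M)
    inner : ∀ J → Σ[ Ss ] (λ K → ⟦ K ⊆ᵇ M ⟧ ⟦ isIndep G (J ∪ K) ⟧ g (J ∪ K))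
                ≡ ⟦ isIndep G J ⟧ Σ[ Ss ] (λ K → ⟦ free J K ⟧ g (J ∪ K))
    inner J = trans (Σ-cong Ss λ K → trans (⟦⟧-∧ (K ⊆ᵇ M) _)
                                     (trans (cong (λ b → ⟦ b ⟧ g (J ∪ K)) (isIndep-∪ G J K M))
                                            (sym (⟦⟧-∧ (isIndep G J) (free J K)))))
                    (Σ-⟦⟧ Ss (isIndep G J) _)

  Σ-indep-∪-weight : ∀ (M : VSet n) (m m′ : VSet n → Carrier) →
    (∀ J K → (J ⊆ᵇ ∁ M) ≡ true → (K ⊆ᵇ M) ≡ true → m (J ∪ K) ≡ m′ K) →
    Σ[ allSubsets n ] (λ T → ⟦ isIndep G T ⟧ (m T * weight T))
    ≡ Σ[ allSubsets n ] (λ J → ⟦ (J ⊆ᵇ ∁ M) ∧ isIndep G J ⟧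
        (weight J * Σ[ allSubsets n ] (λ K → ⟦ isIndep G K ∧ (K ⊆ᵇ uncovered G J M) ⟧ (m′ K * weight K))))
  Σ-indep-∪-weight M m m′ m≡m′ =
    trans (Σ-indep-∪ M _) (Σ-cong Ss λ J → ⟦⟧-cong ((J ⊆ᵇ ∁ M) ∧ isIndep G J) λ J-ok →
      trans (Σ-cong Ss λ K → trans (⟦⟧-cong (isIndep G K ∧ (K ⊆ᵇ uncovered G J M)) λ K-ok →
                                      factor J K (proj₁ (to ∧≡true⇔ J-ok))
                                        (⊆ᵇ-uncovered⇒⊆ᵇ G J K M (proj₂ (to ∧≡true⇔ K-ok))))
                                    (⟦⟧-*ˡ _ (weight J) _))
            (Σ-*ˡ Ss (weight J) _))
    where
    Ss : List (VSet n)
    Ss = allSubsets n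
    factor : ∀ J K → (J ⊆ᵇ ∁ M) ≡ true → (K ⊆ᵇ M) ≡ true →
             m (J ∪ K) * weight (J ∪ K) ≡ weight J * (m′ K * weight K)
    factor J K J⊆∁M K⊆M = begin
      m (J ∪ K) * weight (J ∪ K)
        ≡⟨ cong₂ _*_ (m≡m′ J K J⊆∁M K⊆M) (cong (fug ^_) (card-∪ M J K J⊆∁M K⊆M)) ⟩
      m′ K * fug ^ (card J ℕ.+ card K)
        ≡⟨ cong (m′ K *_) (^-distribˡ-+-* fug (card J) (card K)) ⟩
      m′ K * (weight J * weight K)
        ≡⟨ x*[y*z]≡y*[x*z] (m′ K) (weight J) (weight K) ⟩
      weight J * (m′ K * weight K)
        ∎
      where open ≡-Reasoning

  isIndepOutside : Fin n → VSet n → Bool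
  isIndepOutside u J = (J ⊆ᵇ ∁ (nbhd G u)) ∧ isIndep G J

  outsideWeight : Fin n → Carrier
  outsideWeight u = Σ[ allSubsets n ] (λ J → ⟦ isIndepOutside u J ⟧ weight J)

  ZG≡Σ-outside : ∀ u → ZG K G fug
    ≡ Σ[ allSubsets n ] (λ J → ⟦ isIndepOutside u J ⟧ (weight J * Z K G (uncovered G J (nbhd G u)) fug))
  ZG≡Σ-outside u = begin
    ZG K G fug
      ≡⟨ Σ-indepSets weight ⟩
    Σ[ Ss ] (λ T → ⟦ isIndep G T ⟧ weight T)
      ≡⟨ Σ-cong Ss (λ T → cong (⟦ isIndep G T ⟧_) (*-identityˡ (weight T))) ⟨
    Σ[ Ss ] (λ T → ⟦ isIndep G T ⟧ (1# * weight T))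
      ≡⟨ Σ-indep-∪-weight (nbhd G u) _ _ (λ _ _ _ _ → refl) ⟩
    Σ[ Ss ] (λ J → ⟦ isIndepOutside u J ⟧ (weight J * Σ[ Ss ] (λ K → ⟦ free J K ⟧ (1# * weight K))))
      ≡⟨ Σ-cong Ss (λ J → cong (λ z → ⟦ isIndepOutside u J ⟧ (weight J * z))
           (trans (Σ-cong Ss λ K → cong (⟦ free J K ⟧_) (*-identityˡ (weight K)))
                  (sym (Σ-indepSetsIn (uncovered G J (nbhd G u)) weight)))) ⟩
    Σ[ Ss ] (λ J → ⟦ isIndepOutside u J ⟧ (weight J * Z K G (uncovered G J (nbhd G u)) fug))
      ∎
    where
    open ≡-Reasoning
    Ss : List (VSet n)
    Ss = allSubsets n
    free : VSet n → VSet n → Bool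
    free J K = isIndep G K ∧ (K ⊆ᵇ uncovered G J (nbhd G u))

  neighbourWeight≡Σ-outside : ∀ u → neighbourWeight u
    ≡ Σ[ allSubsets n ] (λ J → ⟦ isIndepOutside u J ⟧ (weight J * fugZ' K G (uncovered G J (nbhd G u)) fug))
  neighbourWeight≡Σ-outside u =
    trans (Σ-indepSets _)
      (trans (Σ-indep-∪-weight (nbhd G u) (λ T → ι (card (nbhd G u ∩ T))) (ι ∘ card)
                (λ J K J⊆∁N K⊆N → cong (ι ∘ card) (∩-∪-cancel (nbhd G u) J K J⊆∁N K⊆N)))
        (Σ-cong (allSubsets n) λ J → cong (λ z → ⟦ isIndepOutside u J ⟧ (weight J * z))
           (sym (Σ-indepSetsIn (uncovered G J (nbhd G u)) _))))

  occupancyWeight≡θ*outsideWeight : 0# ≤ fug → ∀ u → occupancyWeight u ≡ θ * outsideWeight u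
  occupancyWeight≡θ*outsideWeight 0≤fug u = begin
    occupancyWeight u                          ≡⟨ A≡fug*D ⟩
    fug * D                                    ≡⟨ *-identityʳ _ ⟨
    fug * D * 1#                               ≡⟨ cong (fug * D *_) (⁻¹-inverse (1# + fug) 1+fug≢0) ⟨
    fug * D * ((1# + fug) * (1# + fug) ⁻¹)     ≡⟨ regroup fug D (1# + fug) ((1# + fug) ⁻¹) ⟩
    θ * ((1# + fug) * D)                       ≡⟨ cong (θ *_) C≡[1+fug]*D ⟨
    θ * outsideWeight u                        ∎
    where
    open ≡-Reasoning
    Ss : List (VSet n)
    Ss = allSubsets n
    D : Carrier
    D = Σ[ Ss ] (λ T → ⟦ not (u ∈ᵇ T) ⟧ ⟦ isIndepOutside u T ⟧ weight T)

    1+fug≢0 : 1# + fug ≢ 0#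
    1+fug≢0 = 1≤⇒≢0 (1≤1+x 0≤fug)

    regroup : ∀ f d e i → f * d * (e * i) ≡ (f * i) * (e * d)
    regroup = solve 4 (λ f d e i → (f ⊗ d ⊗ (e ⊗ i)) ⊜ ((f ⊗ i) ⊗ (e ⊗ d))) refl

    toggled : ∀ T → ⟦ isIndep G (toggle u T) ⟧ ⟦ u ∈ᵇ toggle u T ⟧ weight (toggle u T)
                  ≡ fug * ⟦ not (u ∈ᵇ T) ⟧ ⟦ isIndepOutside u T ⟧ weight T
    toggled T rewrite ∈ᵇ-toggle u T with u ∈ᵇ T in u∈?T
    ... | true  = trans (⟦⟧-0 (isIndep G (toggle u T))) (sym (zeroʳ fug))
    ... | false = trans (cong₂ (λ b x → ⟦ b ⟧ x) (isIndep-toggle G u T u∈?T)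
                                                (cong (fug ^_) (card-toggle u T u∈?T)))
                        (⟦⟧-*ˡ (isIndepOutside u T) fug (weight T))

    A≡fug*D : occupancyWeight u ≡ fug * D
    A≡fug*D = trans (Σ-indepSets _) (trans (Σ-allSubsets-toggle u _) (trans (Σ-cong Ss toggled) (Σ-*ˡ Ss fug _)))

    split : ∀ T → ⟦ isIndepOutside u T ⟧ weight T
                ≡ ⟦ isIndep G T ⟧ ⟦ u ∈ᵇ T ⟧ weight T
                  + ⟦ not (u ∈ᵇ T) ⟧ ⟦ isIndepOutside u T ⟧ weight T
    split T with u ∈ᵇ T in u∈?T
    ... | true  = trans (cong (λ b → ⟦ b ⟧ weight T) (isIndep-∋ G u T u∈?T)) (sym (+-identityʳ _))
    ... | false = sym (trans (cong (_+ ⟦ isIndepOutside u T ⟧ weight T) (⟦⟧-0 (isIndep G T))) (+-identityˡ _))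

    C≡[1+fug]*D : outsideWeight u ≡ (1# + fug) * D
    C≡[1+fug]*D = begin
      outsideWeight u                    ≡⟨ trans (Σ-cong Ss split) (Σ-+ Ss _ _) ⟩
      Σ[ Ss ] (λ T → ⟦ isIndep G T ⟧ ⟦ u ∈ᵇ T ⟧ weight T) + D
                                         ≡⟨ cong (_+ D) (trans (sym (Σ-indepSets _)) A≡fug*D) ⟩
      fug * D + D                        ≡⟨ +-comm _ D ⟩
      D + fug * D                        ≡⟨ cong (_+ fug * D) (*-identityˡ D) ⟨
      1# * D + fug * D                   ≡⟨ distribʳ D 1# fug ⟨
      (1# + fug) * D                     ∎

  module _ {β γ : Carrier} (0≤fug : 0# ≤ fug) (local : LocalOccupancy K G β γ fug) where

    ZG≤β*occupancyWeight+γ*neighbourWeight : ∀ u → ZG K G fug ≤ β * occupancyWeight u + γ * neighbourWeight u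
    ZG≤β*occupancyWeight+γ*neighbourWeight u = subst₂ _≤_ (sym (ZG≡Σ-outside u)) linear
      (Σ-mono Ss λ J → ⟦⟧-mono (isIndepOutside u J)
         (*-monoˡ-≤-nonneg (^-nonneg (card J) 0≤fug) (local-bound J)))
      where
      open ≡-Reasoning
      Ss : List (VSet n)
      Ss = allSubsets n
      U : VSet n → VSet n
      U J = uncovered G J (nbhd G u)

      local-bound : ∀ J → Z K G (U J) fug ≤ β * θ + γ * fugZ' K G (U J) fug
      local-bound J = 1≤÷⇒≤ (1≤Z 0≤fug (U J))
        (subst (1# ≤_) (trans (cong (λ t → β * θ * t + γ * (Z′ ÷ Z₀)) (*-identityˡ _)) (factor-⁻¹ _ _ _ _))
               (local u (U J) (from (⊆ᵇ⇔⊆ (U J) (nbhd G u)) (uncovered-⊆ G J (nbhd G u)))))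
        where
        Z₀ Z′ : Carrier
        Z₀ = Z K G (U J) fug
        Z′ = fugZ' K G (U J) fug
        factor-⁻¹ : ∀ a g z i → a * i + g * (z * i) ≡ (a + g * z) * i
        factor-⁻¹ a g z i = sym (trans (distribʳ i a (g * z)) (cong (a * i +_) (*-assoc g z i)))

      distribute : ∀ b w z → ⟦ b ⟧ (w * (β * θ + γ * z)) ≡ β * θ * ⟦ b ⟧ w + γ * ⟦ b ⟧ (w * z)
      distribute true  w z = expand (β * θ) γ w z
        where
        expand : ∀ a g w z → w * (a + g * z) ≡ a * w + g * (w * z)
        expand a g w z = trans (distribˡ w a (g * z)) (cong₂ _+_ (*-comm w a) (x*[y*z]≡y*[x*z] w g z))
      distribute false w z = sym (trans (cong₂ _+_ (zeroʳ _) (zeroʳ γ)) (+-identityˡ 0#))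

      linear : Σ[ Ss ] (λ J → ⟦ isIndepOutside u J ⟧ (weight J * (β * θ + γ * fugZ' K G (U J) fug)))
             ≡ β * occupancyWeight u + γ * neighbourWeight u
      linear = begin
        Σ[ Ss ] (λ J → ⟦ isIndepOutside u J ⟧ (weight J * (β * θ + γ * fugZ' K G (U J) fug)))
          ≡⟨ trans (Σ-cong Ss λ J → distribute (isIndepOutside u J) _ _) (Σ-+ Ss _ _) ⟩
        Σ[ Ss ] (λ J → β * θ * ⟦ isIndepOutside u J ⟧ weight J)
          + Σ[ Ss ] (λ J → γ * ⟦ isIndepOutside u J ⟧ (weight J * fugZ' K G (U J) fug))
          ≡⟨ cong₂ _+_ (Σ-*ˡ Ss _ _)
                       (trans (Σ-*ˡ Ss γ _) (cong (γ *_) (sym (neighbourWeight≡Σ-outside u)))) ⟩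
        β * θ * outsideWeight u + γ * neighbourWeight u
          ≡⟨ cong (_+ γ * neighbourWeight u)
                  (trans (*-assoc β θ _) (cong (β *_) (sym (occupancyWeight≡θ*outsideWeight 0≤fug u)))) ⟩
        β * occupancyWeight u + γ * neighbourWeight u
          ∎

    n*ZG≤Σ-occupancyWeight :
      ι n * ZG K G fug ≤ Σ[ allFin n ] (λ u → occupancyWeight u * (β + ι (degree G u) * γ))
    n*ZG≤Σ-occupancyWeight =
      subst₂ _≤_ (Σ-allFin-const n _) linear (Σ-mono Vs ZG≤β*occupancyWeight+γ*neighbourWeight)
      where
      open ≡-Reasoning
      Vs : List (Fin n)
      Vs = allFin n
      collect : ∀ a d → β * a + γ * (a * d) ≡ a * (β + d * γ)
      collect a d = sym (trans (distribˡ a β (d * γ))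
                              (cong₂ _+_ (*-comm a β) (trans (sym (*-assoc a d γ)) (*-comm (a * d) γ))))
      linear : Σ[ Vs ] (λ u → β * occupancyWeight u + γ * neighbourWeight u)
             ≡ Σ[ Vs ] (λ u → occupancyWeight u * (β + ι (degree G u) * γ))
      linear = begin
        Σ[ Vs ] (λ u → β * occupancyWeight u + γ * neighbourWeight u)
          ≡⟨ Σ-+ Vs _ _ ⟩
        Σ[ Vs ] (λ u → β * occupancyWeight u) + Σ[ Vs ] (λ u → γ * neighbourWeight u)
          ≡⟨ cong (_ +_) (trans (Σ-*ˡ Vs γ _)
                          (trans (cong (γ *_) (sym Σ-occupancyWeight*degree)) (sym (Σ-*ˡ Vs γ _)))) ⟩
        Σ[ Vs ] (λ u → β * occupancyWeight u) + Σ[ Vs ] (λ u → γ * (occupancyWeight u * ι (degree G u)))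
          ≡⟨ trans (sym (Σ-+ Vs _ _)) (Σ-cong Vs λ u → collect (occupancyWeight u) (ι (degree G u))) ⟩
        Σ[ Vs ] (λ u → occupancyWeight u * (β + ι (degree G u) * γ))
          ∎

  Σ-occProb : ∀ (w : Fin n → Carrier) →
    Σ[ allFin n ] (λ u → occProb K G fug u * w u)
    ≡ ZG K G fug ⁻¹ * Σ[ allFin n ] (λ u → occupancyWeight u * w u)
  Σ-occProb w =
    trans (Σ-cong (allFin n) λ u → x*y*z≡y*[x*z] (occupancyWeight u) _ (w u)) (Σ-*ˡ (allFin n) _ _)

theorem2p1 : ∀ {c ℓ} (K : OrderedField c ℓ) → let open OrderedField K in
    ∀ (n : ℕ) → 1 Data.Nat.≤ n → (G : Graph n) → (fug β γ : Carrier) →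
      0# < fug → 0# < β → 0# < γ →
      LocalOccupancy K G β γ fug →
      1# ≤ (1# ÷ ι n) * Σ[ allFin n ] (λ u → occProb K G fug u * (β + ι (degree G u) * γ))
theorem2p1 K n@(ℕ.suc k) _ G fug β γ (0≤fug , _) _ _ local =
  subst (1# ≤_) (trans (*-assoc _ _ _) (cong ((1# ÷ ι n) *_) (sym (Σ-occProb _))))
    (≤⇒1≤* 0≤[1÷n]*Z⁻¹ ([1÷x]*y⁻¹*[x*y]≡1 n≢0 Z≢0) (n*ZG≤Σ-occupancyWeight 0≤fug local))
  where
  open OrderedField K
  open OrderedFieldProperties K
  open HardCoreModel K G fug
  open IsCommutativeRing isCommutativeRing using (*-assoc)
  1≤n : 1# ≤ ι n
  1≤n = 1≤1+x (ι-nonneg k)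
  n≢0 : ι n ≢ 0#
  n≢0 = 1≤⇒≢0 1≤n
  1≤ZG : 1# ≤ ZG K G fug
  1≤ZG = 1≤Z 0≤fug (fullSet n)
  Z≢0 : ZG K G fug ≢ 0#
  Z≢0 = 1≤⇒≢0 1≤ZG
  0≤[1÷n]*Z⁻¹ : 0# ≤ (1# ÷ ι n) * ZG K G fug ⁻¹
  0≤[1÷n]*Z⁻¹ =
    *-nonneg _ _ (*-nonneg _ _ 0≤1 (⁻¹-nonneg (1≤⇒0≤ 1≤n) n≢0)) (⁻¹-nonneg (1≤⇒0≤ 1≤ZG) Z≢0)
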